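{- Let $p\geq 5$ be prime and let $1\leq r\leq p-1$ be an integer such that $24r+1$ is a quadratic nonresidue modulo $p$. Then for all integers $m\geq 0$, $\overline{C}_{6,2}(pm+r)\equiv 0\pmod 2$.
   Context: An overpartition of $n$ is a partition of $n$ in which the first occurrence of each distinct part may optionally be overlined. $\overline{C}_{6,2}(n)$ denotes the number of overpartitions of $n$ in which no part is divisible by $6$ and only parts congruent to $\pm 2 \pmod{6}$ may be overlined; equivalently $\sum_{n\ge0}\overline{C}_{6,2}(n)q^n=\frac{(q^6;q^6)_\infty(-q^2;q^6)_\infty(-q^4;q^6)_\infty}{(q;q)_\infty}$, where $(A;q)_\infty=\prod_{j\ge0}(1-Aq^j)$. -}

module Defs where

open import Data.Nat using (ℕ; zero; suc; _+_; _*_; _∸_; _≤?_)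
open import Data.Nat.DivMod using (_%_)
open import Data.Bool using (Bool; true; false; if_then_else_)
open import Data.Product using (_×_; _,_)
open import Data.List using (List; []; _∷_; [_]; _++_; map; concatMap; replicate; length; upTo; filter)
open import Relation.Nullary.Decidable using (⌊_⌋)

-- An overpartition is represented as a list of (part , overlined?) pairs,
-- parts listed in non-increasing order; for a part size occurring j ≥ 1 times,
-- only its first occurrence may carry the overline flag 'true'.

overlineAllowed : ℕ → Bool
overlineAllowed s with s % 6
... | 2 = true
... | 4 = true
... | _ = false

partAllowed : ℕ → Bool
partAllowed s with s % 6
... | 0 = false
... | _ = true

blocks : ℕ → ℕ → List (List (ℕ × Bool))
blocks s zero = [ [] ]
blocks s (suc j) =
  if partAllowed s
  then (replicate (suc j) (s , false) ∷
         (if overlineAllowed s then [ (s , true) ∷ replicate j (s , false) ] else []))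
  else []

-- ops k n : all overpartitions of n (of the restricted kind) with all parts in {1,…,k}.
ops : ℕ → ℕ → List (List (ℕ × Bool))
ops zero zero = [ [] ]
ops zero (suc n) = []
ops (suc k) n =
  concatMap
    (λ j → concatMap (λ b → map (b ++_) (ops k (n ∸ j * suc k))) (blocks (suc k) j))
    (filter (λ j → j * suc k ≤? n) (upTo (suc n)))

-- C̄_{6,2}(n): number of overpartitions of n with no part divisible by 6 and
-- where only parts ≡ ±2 (mod 6) may be overlined.
Cbar62 : ℕ → ℕ
Cbar62 n = length (ops n n)

module Submission where

open import Defs
open import Algebra.Bundles using (CommutativeRing)
open import Data.Bool using (Bool; true; false; _xor_; not; _∧_; if_then_else_; T)
open import Data.Bool.Properties
  using (xor-∧-commutativeRing; xor-assoc; xor-same; xor-identityʳ; not-involutive; ∧-zeroʳ; ∧-assoc; ∧-comm)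
open import Algebra.Properties.CommutativeSemigroup
  (CommutativeRing.+-commutativeSemigroup xor-∧-commutativeRing) using (interchange)
open import Data.Empty using (⊥-elim)
open import Data.Integer using (ℤ; +_)
import Data.Integer as Z
import Data.Integer.Properties as Zₚ
open import Data.Integer.Divisibility using (_∣_)
open import Data.List using (List; []; _∷_; _++_; [_]; map; reverse; length; concatMap; filter; applyUpTo; upTo)
open import Data.List.Properties using (unfold-reverse; length-++; length-map)
open import Data.List.Relation.Unary.All using (All; []; _∷_)
open import Data.List.Relation.Binary.Permutation.Propositional as ↭ using (_↭_; prep; swap; ↭-sym)
import Data.List.Relation.Binary.Permutation.Propositional.Properties as ↭
open import Data.Nat using (ℕ; zero; suc; _+_; _*_; _∸_; _≤_; _<_; z≤n; s≤s; _≡ᵇ_; _≤?_; _<?_)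
open import Data.Nat.Properties
open import Data.Nat.DivMod using (_%_; _/_; m≡m%n+[m/n]*n; m%n<n; m*n%n≡0)
open import Data.Nat.Divisibility using (m∣m*n) renaming (_∣_ to _∣ℕ_)
open import Data.Nat.Induction using (<-rec)
open import Data.Nat.Primality using (Prime)
open import Data.Nat.Tactic.RingSolver using (solve-∀)
open import Data.Product using (_×_; ∃; ∃-syntax; _,_)
open import Data.Sum using (_⊎_; inj₁; inj₂)
open import Data.Unit using (tt)
open import Relation.Binary.PropositionalEquality hiding ([_])
open import Relation.Nullary using (¬_; yes; no; does)
open import Relation.Nullary.Decidable using (dec-true; dec-false)
open import Relation.Unary using (Decidable)

xor-cancelʳ : ∀ a b → (a xor b) xor b ≡ a
xor-cancelʳ a b = begin
  (a xor b) xor b  ≡⟨ xor-assoc a b b ⟩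
  a xor (b xor b)  ≡⟨ cong (a xor_) (xor-same b) ⟩
  a xor false      ≡⟨ xor-identityʳ a ⟩
  a                ∎
  where open ≡-Reasoning

xor-cancel-middle : ∀ a b c → (a xor b) xor (b xor c) ≡ a xor c
xor-cancel-middle a b c = begin
  (a xor b) xor (b xor c)  ≡⟨ xor-assoc a b (b xor c) ⟩
  a xor (b xor (b xor c))  ≡⟨ cong (a xor_) (sym (xor-assoc b b c)) ⟩
  a xor ((b xor b) xor c)  ≡⟨ cong (λ z → a xor (z xor c)) (xor-same b) ⟩
  a xor c                  ∎
  where open ≡-Reasoning

xor-cancelˡ : ∀ a b → a xor (a xor b) ≡ b
xor-cancelˡ a b = trans (sym (xor-assoc a a b)) (cong (_xor b) (xor-same a))

xor-true : ∀ a b c → (a xor b) xor c ≡ true → (a ≡ true ⊎ b ≡ true) ⊎ c ≡ true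
xor-true true b c _ = inj₁ (inj₁ refl)
xor-true false true c _ = inj₁ (inj₂ refl)
xor-true false false c eq = inj₂ eq

Series : Set
Series = ℕ → Bool

infixl 6 _⊕_
_⊕_ : Series → Series → Series
(f ⊕ g) i = f i xor g i

𝟘 : Series
𝟘 _ = false

q^_ : ℕ → Series
(q^ e) i = i ≡ᵇ e

𝟙 : Series
𝟙 = q^ 0

infix 4 _≈[_]_
_≈[_]_ : Series → ℕ → Series → Set
f ≈[ n ] g = ∀ i → i ≤ n → f i ≡ g i

≗⇒≈ : ∀ {n f g} → f ≗ g → f ≈[ n ] g
≗⇒≈ e i _ = e i

≈-trans : ∀ {n f g h} → f ≈[ n ] g → g ≈[ n ] h → f ≈[ n ] h
≈-trans a b i le = trans (a i le) (b i le)

≈-weaken : ∀ {m n f g} → f ≈[ n ] g → m ≤ n → f ≈[ m ] g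
≈-weaken e m≤n i le = e i (≤-trans le m≤n)

≗-trans : ∀ {f g h : Series} → f ≗ g → g ≗ h → f ≗ h
≗-trans a b i = trans (a i) (b i)

q^-high : ∀ {n e} → n < e → q^ e ≈[ n ] 𝟘
q^-high {e = e} n<e i i≤n = ≡ᵇ-false i e (≤-<-trans i≤n n<e)
  where
  ≡ᵇ-false : ∀ i e → i < e → (i ≡ᵇ e) ≡ false
  ≡ᵇ-false zero (suc e) _ = refl
  ≡ᵇ-false (suc i) (suc e) (s≤s i<e) = ≡ᵇ-false i e i<e

Causal : (Series → Series) → Set
Causal F = ∀ n {f g} → f ≈[ n ] g → F f ≈[ n ] F g

causal-cong : ∀ {F} → Causal F → ∀ {f g} → f ≗ g → F f ≗ F g
causal-cong causal f≗g i = causal i (≗⇒≈ f≗g) i ≤-refl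

shift : ℕ → Series → Series
shift zero f i = f i
shift (suc x) f zero = false
shift (suc x) f (suc i) = shift x f i

shift-causal : ∀ x → Causal (shift x)
shift-causal zero n e = e
shift-causal (suc x) n e zero _ = refl
shift-causal (suc x) n e (suc i) le = shift-causal x n e i (≤-trans (n≤1+n i) le)

shift-low : ∀ x f i → i < x → shift x f i ≡ false
shift-low (suc x) f zero _ = refl
shift-low (suc x) f (suc i) (s≤s i<x) = shift-low x f i i<x

shift-at : ∀ x f n → shift x f (x + n) ≡ f n
shift-at zero f n = refl
shift-at (suc x) f n = shift-at x f n

shift-+ : ∀ a b f → shift a (shift b f) ≗ shift (a + b) f
shift-+ zero b f i = refl
shift-+ (suc a) b f zero = refl
shift-+ (suc a) b f (suc i) = shift-+ a b f i

shift-comm : ∀ a b f → shift a (shift b f) ≗ shift b (shift a f)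
shift-comm a b f i = begin
  shift a (shift b f) i  ≡⟨ shift-+ a b f i ⟩
  shift (a + b) f i      ≡⟨ cong (λ c → shift c f i) (+-comm a b) ⟩
  shift (b + a) f i      ≡⟨ shift-+ b a f i ⟨
  shift b (shift a f) i  ∎
  where open ≡-Reasoning

shift-⊕ : ∀ x f g → shift x (f ⊕ g) ≗ shift x f ⊕ shift x g
shift-⊕ zero f g i = refl
shift-⊕ (suc x) f g zero = refl
shift-⊕ (suc x) f g (suc i) = shift-⊕ x f g i

shift-𝟘 : ∀ x → shift x 𝟘 ≗ 𝟘
shift-𝟘 zero i = refl
shift-𝟘 (suc x) zero = refl
shift-𝟘 (suc x) (suc i) = shift-𝟘 x i

shift-q^ : ∀ x e → shift x (q^ e) ≗ q^ (x + e)
shift-q^ zero e i = refl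
shift-q^ (suc x) e zero = refl
shift-q^ (suc x) e (suc i) = shift-q^ x e i

infixr 7 [1+q^_]·_
[1+q^_]·_ : ℕ → Series → Series
[1+q^ x ]· f = f ⊕ shift x f

[1+q^]-causal : ∀ x → Causal ([1+q^ x ]·_)
[1+q^]-causal x n e i le = cong₂ _xor_ (e i le) (shift-causal x n e i le)

[1+q^]-cong : ∀ x {f g} → f ≗ g → [1+q^ x ]· f ≗ [1+q^ x ]· g
[1+q^]-cong x = causal-cong ([1+q^]-causal x)

[1+q^]-comm : ∀ a b f → [1+q^ a ]· [1+q^ b ]· f ≗ [1+q^ b ]· [1+q^ a ]· f
[1+q^]-comm a b f i = begin
  (f i xor shift b f i) xor shift a (f ⊕ shift b f) i
    ≡⟨ cong ((f i xor shift b f i) xor_) (shift-⊕ a f (shift b f) i) ⟩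
  (f i xor shift b f i) xor (shift a f i xor shift a (shift b f) i)
    ≡⟨ interchange (f i) (shift b f i) (shift a f i) (shift a (shift b f) i) ⟩
  (f i xor shift a f i) xor (shift b f i xor shift a (shift b f) i)
    ≡⟨ cong (λ z → (f i xor shift a f i) xor (shift b f i xor z)) (shift-comm a b f i) ⟩
  (f i xor shift a f i) xor (shift b f i xor shift b (shift a f) i)
    ≡⟨ cong ((f i xor shift a f i) xor_) (shift-⊕ b f (shift a f) i) ⟨
  (f i xor shift a f i) xor shift b (f ⊕ shift a f) i
    ∎
  where open ≡-Reasoning

[1+q^]-⊕ : ∀ x f g → [1+q^ x ]· (f ⊕ g) ≗ [1+q^ x ]· f ⊕ [1+q^ x ]· g
[1+q^]-⊕ x f g i = begin
  (f i xor g i) xor shift x (f ⊕ g) i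
    ≡⟨ cong ((f i xor g i) xor_) (shift-⊕ x f g i) ⟩
  (f i xor g i) xor (shift x f i xor shift x g i)
    ≡⟨ interchange (f i) (g i) (shift x f i) (shift x g i) ⟩
  (f i xor shift x f i) xor (g i xor shift x g i)
    ∎
  where open ≡-Reasoning

[1+q^]-𝟘 : ∀ x → [1+q^ x ]· 𝟘 ≗ 𝟘
[1+q^]-𝟘 x = shift-𝟘 x

[1+q^]-q^ : ∀ x e → [1+q^ x ]· q^ e ≗ q^ e ⊕ q^ (x + e)
[1+q^]-q^ x e i = cong ((q^ e) i xor_) (shift-q^ x e i)

-- Frobenius in characteristic 2: (1 + q^x)² = 1 + q^(2x).
[1+q^]-square : ∀ x f → [1+q^ x ]· [1+q^ x ]· f ≗ [1+q^ (x + x) ]· f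
[1+q^]-square x f i = begin
  (f i xor shift x f i) xor shift x (f ⊕ shift x f) i
    ≡⟨ cong ((f i xor shift x f i) xor_) (shift-⊕ x f (shift x f) i) ⟩
  (f i xor shift x f i) xor (shift x f i xor shift x (shift x f) i)
    ≡⟨ xor-cancel-middle (f i) (shift x f i) (shift x (shift x f) i) ⟩
  f i xor shift x (shift x f) i
    ≡⟨ cong (f i xor_) (shift-+ x x f i) ⟩
  f i xor shift (x + x) f i
    ∎
  where open ≡-Reasoning

[1+q^]-high : ∀ x n f → n < x → [1+q^ x ]· f ≈[ n ] f
[1+q^]-high x n f n<x i i≤n =
  trans (cong (f i xor_) (shift-low x f i (≤-<-trans i≤n n<x))) (xor-identityʳ (f i))

infixr 7 ∏[1+q^_]·_
∏[1+q^_]·_ : List ℕ → Series → Series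
∏[1+q^ [] ]· f = f
∏[1+q^ x ∷ xs ]· f = [1+q^ x ]· ∏[1+q^ xs ]· f

∏-causal : ∀ xs → Causal (∏[1+q^ xs ]·_)
∏-causal [] n e = e
∏-causal (x ∷ xs) n e = [1+q^]-causal x n (∏-causal xs n e)

∏-cong : ∀ xs {f g} → f ≗ g → ∏[1+q^ xs ]· f ≗ ∏[1+q^ xs ]· g
∏-cong xs = causal-cong (∏-causal xs)

∏-⊕ : ∀ xs f g → ∏[1+q^ xs ]· (f ⊕ g) ≗ ∏[1+q^ xs ]· f ⊕ ∏[1+q^ xs ]· g
∏-⊕ [] f g i = refl
∏-⊕ (x ∷ xs) f g =
  ≗-trans ([1+q^]-cong x (∏-⊕ xs f g)) ([1+q^]-⊕ x (∏[1+q^ xs ]· f) (∏[1+q^ xs ]· g))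

∏-𝟘 : ∀ xs → ∏[1+q^ xs ]· 𝟘 ≗ 𝟘
∏-𝟘 [] i = refl
∏-𝟘 (x ∷ xs) = ≗-trans ([1+q^]-cong x (∏-𝟘 xs)) ([1+q^]-𝟘 x)

∏-++ : ∀ xs ys f → ∏[1+q^ xs ++ ys ]· f ≡ ∏[1+q^ xs ]· ∏[1+q^ ys ]· f
∏-++ [] ys f = refl
∏-++ (x ∷ xs) ys f = cong ([1+q^ x ]·_) (∏-++ xs ys f)

∏-perm : ∀ {xs ys} → xs ↭ ys → ∀ f → ∏[1+q^ xs ]· f ≗ ∏[1+q^ ys ]· f
∏-perm ↭.refl f i = refl
∏-perm (prep x p) f = [1+q^]-cong x (∏-perm p f)
∏-perm {ys = _ ∷ _ ∷ ys} (swap x y p) f =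
  ≗-trans ([1+q^]-cong x ([1+q^]-cong y (∏-perm p f)))
          ([1+q^]-comm x y (∏[1+q^ ys ]· f))
∏-perm (↭.trans p p′) f = ≗-trans (∏-perm p f) (∏-perm p′ f)

∏-[1+q^]-comm : ∀ xs x f → ∏[1+q^ xs ]· [1+q^ x ]· f ≗ [1+q^ x ]· ∏[1+q^ xs ]· f
∏-[1+q^]-comm [] x f i = refl
∏-[1+q^]-comm (y ∷ ys) x f =
  ≗-trans ([1+q^]-cong y (∏-[1+q^]-comm ys x f)) ([1+q^]-comm y x (∏[1+q^ ys ]· f))

double : ℕ → ℕ
double k = k + k

∏-square : ∀ xs f → ∏[1+q^ xs ]· ∏[1+q^ xs ]· f ≗ ∏[1+q^ map double xs ]· f
∏-square [] f i = refl
∏-square (x ∷ xs) f =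
  ≗-trans ([1+q^]-cong x (∏-[1+q^]-comm xs x (∏[1+q^ xs ]· f)))
  (≗-trans ([1+q^]-square x (∏[1+q^ xs ]· ∏[1+q^ xs ]· f)) ([1+q^]-cong (x + x) (∏-square xs f)))

-- The substitution q ↦ q², sending f(q) to f(q²).
frob : Series → Series
frob f zero = f zero
frob f (suc zero) = false
frob f (suc (suc i)) = frob (λ j → f (suc j)) i

frob-⊕ : ∀ f g → frob (f ⊕ g) ≗ frob f ⊕ frob g
frob-⊕ f g zero = refl
frob-⊕ f g (suc zero) = refl
frob-⊕ f g (suc (suc i)) = frob-⊕ (λ j → f (suc j)) (λ j → g (suc j)) i

frob-𝟘 : frob 𝟘 ≗ 𝟘
frob-𝟘 zero = refl
frob-𝟘 (suc zero) = refl
frob-𝟘 (suc (suc i)) = frob-𝟘 i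

frob-𝟙 : frob 𝟙 ≗ 𝟙
frob-𝟙 zero = refl
frob-𝟙 (suc zero) = refl
frob-𝟙 (suc (suc i)) = frob-𝟘 i

frob-≈ : ∀ n {g h} → g ≈[ n ] h → frob g ≈[ suc (n + n) ] frob h
frob-≈ n e zero _ = e zero z≤n
frob-≈ n e (suc zero) _ = refl
frob-≈ (suc n) e (suc (suc i)) (s≤s (s≤s i≤)) =
  frob-≈ n (λ j j≤n → e (suc j) (s≤s j≤n)) i (subst (i ≤_) (+-suc n n) i≤)

frob-shift : ∀ k f → shift (k + k) (frob f) ≗ frob (shift k f)
frob-shift zero f i = refl
frob-shift (suc k) f i rewrite +-suc k k = shift₂ i
  where
  shift₂ : ∀ i → shift (suc (suc (k + k))) (frob f) i ≡ frob (shift (suc k) f) i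
  shift₂ zero = refl
  shift₂ (suc zero) = refl
  shift₂ (suc (suc i)) = frob-shift k f i

frob-[1+q^] : ∀ k f → [1+q^ (k + k) ]· frob f ≗ frob ([1+q^ k ]· f)
frob-[1+q^] k f i = trans (cong (frob f i xor_) (frob-shift k f i)) (sym (frob-⊕ f (shift k f) i))

∏-frob : ∀ xs f → ∏[1+q^ map double xs ]· frob f ≗ frob (∏[1+q^ xs ]· f)
∏-frob [] f i = refl
∏-frob (x ∷ xs) f =
  ≗-trans ([1+q^]-cong (x + x) (∏-frob xs f)) (frob-[1+q^] x (∏[1+q^ xs ]· f))

positives : ℕ → List ℕ
positives zero = []
positives (suc n) = suc n ∷ positives n

odds : ℕ → List ℕ
odds zero = []
odds (suc m) = suc (m + m) ∷ odds m

-- eulerProd n = (q;q)_n = ∏_{k ≤ n} (1 - q^k), reduced modulo 2.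
eulerProd : ℕ → Series
eulerProd n = ∏[1+q^ positives n ]· 𝟙

positives-even : ∀ m → positives (m + m) ↭ odds m ++ map double (positives m)
positives-even zero = ↭.refl
positives-even (suc m) rewrite +-suc m m =
  ↭.trans (swap (suc (suc (m + m))) (suc (m + m)) ↭.refl)
    (prep (suc (m + m)) (↭.trans (prep (suc (suc (m + m))) (positives-even m))
      (↭-sym (↭.shift (suc (suc (m + m))) (odds m) (map double (positives m))))))

positives-odd : ∀ m → positives (suc (m + m)) ↭ odds (suc m) ++ map double (positives m)
positives-odd m = prep (suc (m + m)) (positives-even m)

odds-extra : ∀ d {c n} h → n ≤ c + c → ∏[1+q^ odds (d + c) ]· h ≈[ n ] ∏[1+q^ odds c ]· h
odds-extra zero h n≤2c i _ = refl
odds-extra (suc d) {c} h n≤2c =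
  ≈-trans ([1+q^]-high (suc ((d + c) + (d + c))) _ _
             (s≤s (≤-trans n≤2c (+-mono-≤ (m≤n+m c d) (m≤n+m c d)))))
          (odds-extra d h n≤2c)

odds-high : ∀ {c c′ n} h → c ≤ c′ → n ≤ c + c → ∏[1+q^ odds c′ ]· h ≈[ n ] ∏[1+q^ odds c ]· h
odds-high {c} {c′} {n} h c≤c′ n≤2c =
  subst (λ k → ∏[1+q^ odds k ]· h ≈[ n ] ∏[1+q^ odds c ]· h) (m∸n+n≡m c≤c′)
        (odds-extra (c′ ∸ c) h n≤2c)

data Halving : ℕ → Set where
  even : ∀ m → Halving (m + m)
  odd  : ∀ m → Halving (suc (m + m))

halve : ∀ n → Halving n
halve zero = even 0
halve (suc n) with halve n
... | even m = odd m
... | odd m = subst Halving (cong suc (+-suc m m)) (even (suc m))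

-- One Frobenius step: the claim for n follows from the claim for m = ⌊n/2⌋,
-- since ∏_{odd} · (q;q)_n = (∏_{odd ≤ n})² · (q²;q²)_m = [∏_{odd} · (q;q)_m](q²).
odd-euler-step : ∀ {n m c} → positives n ↭ odds c ++ map double (positives m) →
  m ≤ c → c ≤ n → n ≤ c + c → n ≤ suc (m + m) →
  ∏[1+q^ odds m ]· eulerProd m ≈[ m ] 𝟙 → ∏[1+q^ odds n ]· eulerProd n ≈[ n ] 𝟙
odd-euler-step {n} {m} {c} split m≤c c≤n n≤2c n≤2m+1 hyp =
  ≈-trans (odds-high (eulerProd n) c≤n n≤2c)
  (≈-trans (≗⇒≈ as-frob)
  (≈-trans (≈-weaken (frob-≈ m (≈-trans (odds-high (eulerProd m) m≤c (m≤m+n m m)) hyp)) n≤2m+1)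
  (≗⇒≈ frob-𝟙)))
  where
  oddFactors oddFactors² evenFactors : Series → Series
  oddFactors = ∏[1+q^ odds c ]·_
  oddFactors² = ∏[1+q^ map double (odds c) ]·_
  evenFactors = ∏[1+q^ map double (positives m) ]·_
  as-frob : oddFactors (eulerProd n) ≗ frob (oddFactors (eulerProd m))
  as-frob i = begin
    oddFactors (eulerProd n) i
      ≡⟨ ∏-cong (odds c) (∏-perm split 𝟙) i ⟩
    oddFactors (∏[1+q^ odds c ++ map double (positives m) ]· 𝟙) i
      ≡⟨ cong (λ h → oddFactors h i) (∏-++ (odds c) (map double (positives m)) 𝟙) ⟩
    oddFactors (oddFactors (evenFactors 𝟙)) i
      ≡⟨ ∏-square (odds c) (evenFactors 𝟙) i ⟩
    oddFactors² (evenFactors 𝟙) i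
      ≡⟨ ∏-cong (map double (odds c)) (∏-cong (map double (positives m)) (λ j → sym (frob-𝟙 j))) i ⟩
    oddFactors² (evenFactors (frob 𝟙)) i
      ≡⟨ ∏-cong (map double (odds c)) (∏-frob (positives m) 𝟙) i ⟩
    oddFactors² (frob (eulerProd m)) i
      ≡⟨ ∏-frob (odds c) (eulerProd m) i ⟩
    frob (oddFactors (eulerProd m)) i
      ∎
    where open ≡-Reasoning

odd-euler-cancel : ∀ n → ∏[1+q^ odds n ]· eulerProd n ≈[ n ] 𝟙
odd-euler-cancel = <-rec _ step
  where
  step : ∀ n → (∀ {m} → m < n → ∏[1+q^ odds m ]· eulerProd m ≈[ m ] 𝟙) →
         ∏[1+q^ odds n ]· eulerProd n ≈[ n ] 𝟙
  step n rec with halve n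
  ... | even zero = λ { zero _ → refl }
  ... | even (suc m) =
    odd-euler-step (positives-even (suc m)) ≤-refl (m≤m+n (suc m) (suc m)) ≤-refl (n≤1+n _)
      (rec (s≤s (m≤n+m (suc m) m)))
  ... | odd m =
    odd-euler-step (positives-odd m) (n≤1+n m) (s≤s (m≤m+n m m))
      (s≤s (+-monoʳ-≤ m (n≤1+n m))) ≤-refl (rec (s≤s (m≤m+n m m)))

Σ⊕ : ℕ → (ℕ → Bool) → Bool
Σ⊕ zero h = false
Σ⊕ (suc m) h = h 0 xor Σ⊕ m (λ j → h (suc j))

Σ⊕-cong : ∀ m {h h′} → (∀ j → j < m → h j ≡ h′ j) → Σ⊕ m h ≡ Σ⊕ m h′
Σ⊕-cong zero e = refl
Σ⊕-cong (suc m) e = cong₂ _xor_ (e 0 (s≤s z≤n)) (Σ⊕-cong m (λ j j<m → e (suc j) (s≤s j<m)))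

Σ⊕-truncate : ∀ m M h → m ≤ M → (∀ j → m ≤ j → h j ≡ false) → Σ⊕ M h ≡ Σ⊕ m h
Σ⊕-truncate zero zero h _ _ = refl
Σ⊕-truncate zero (suc M) h _ e =
  cong₂ _xor_ (e 0 z≤n) (Σ⊕-truncate zero M (λ j → h (suc j)) z≤n (λ j _ → e (suc j) z≤n))
Σ⊕-truncate (suc m) (suc M) h (s≤s m≤M) e =
  cong (h 0 xor_) (Σ⊕-truncate m M (λ j → h (suc j)) m≤M (λ j m≤j → e (suc j) (s≤s m≤j)))

Σ⊕-scale : ∀ m c h → Σ⊕ m (λ j → c ∧ h j) ≡ c ∧ Σ⊕ m h
Σ⊕-scale m true h = refl
Σ⊕-scale m false h = Σ⊕-truncate zero m _ z≤n (λ _ _ → refl)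

Σ⊕-last : ∀ m h → Σ⊕ (suc m) h ≡ Σ⊕ m h xor h m
Σ⊕-last zero h = xor-identityʳ (h 0)
Σ⊕-last (suc m) h = trans (cong (h 0 xor_) (Σ⊕-last m (λ j → h (suc j)))) (sym (xor-assoc (h 0) _ _))

Σ⊕-⊕ : ∀ m a b → Σ⊕ m (λ k → a k xor b k) ≡ Σ⊕ m a xor Σ⊕ m b
Σ⊕-⊕ zero a b = refl
Σ⊕-⊕ (suc m) a b =
  trans (cong ((a 0 xor b 0) xor_) (Σ⊕-⊕ m (λ j → a (suc j)) (λ j → b (suc j))))
        (interchange (a 0) (b 0) _ _)

Σ⊕-telescope : ∀ m (v : ℕ → Bool) → Σ⊕ m (λ k → v k xor v (suc k)) ≡ v 0 xor v m
Σ⊕-telescope zero v = sym (xor-same (v 0))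
Σ⊕-telescope (suc m) v =
  trans (cong ((v 0 xor v 1) xor_) (Σ⊕-telescope m (λ k → v (suc k))))
        (xor-cancel-middle (v 0) (v 1) (v (suc m)))

-- Division by 1 - q^s.  The tail (q^s + q^2s + ⋯) · f is computed coefficientwise.
geomTail : ℕ → Series → Series
geomTail s f n = Σ⊕ n (λ j → does (suc j * s ≤? n) ∧ f (n ∸ suc j * s))

infixr 7 [1-q^_]⁻¹·_
[1-q^_]⁻¹·_ : ℕ → Series → Series
([1-q^ s ]⁻¹· f) n = f n xor geomTail s f n

geomTail-low : ∀ s f n → n < s → geomTail s f n ≡ false
geomTail-low s f n n<s = Σ⊕-truncate zero n _ z≤n (λ j _ →
  cong (_∧ f (n ∸ suc j * s)) (dec-false (suc j * s ≤? n) (<⇒≱ (<-≤-trans n<s (m≤m+n s (j * s))))))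

does-+-≤? : ∀ k a b → does (k + a ≤? k + b) ≡ does (a ≤? b)
does-+-≤? zero a b = refl
does-+-≤? (suc k) a b = trans (does-suc (k + a) (k + b)) (does-+-≤? k a b)
  where
  does-suc : ∀ a b → does (suc a ≤? suc b) ≡ does (a ≤? b)
  does-suc zero b = refl
  does-suc (suc a) b = refl

geomTail-step : ∀ s f n → geomTail (suc s) f (suc s + n) ≡ ([1-q^ suc s ]⁻¹· f) n
geomTail-step s f n = cong₂ _xor_ first rest
  where
  k = suc s
  first : (does (k + 0 ≤? k + n) ∧ f (k + n ∸ (k + 0))) ≡ f n
  first = cong₂ _∧_ (does-+-≤? k 0 n) (cong f ([m+n]∸[m+o]≡n∸o k n 0))
  term : ℕ → Bool
  term j = does (suc j * k ≤? n) ∧ f (n ∸ suc j * k)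
  shifted : ∀ j → (does (k + suc j * k ≤? k + n) ∧ f (k + n ∸ (k + suc j * k))) ≡ term j
  shifted j = cong₂ _∧_ (does-+-≤? k (suc j * k) n) (cong f ([m+n]∸[m+o]≡n∸o k n (suc j * k)))
  rest : Σ⊕ (s + n) (λ j → does (k + suc j * k ≤? k + n) ∧ f (k + n ∸ (k + suc j * k))) ≡ geomTail k f n
  rest = trans (Σ⊕-cong (s + n) (λ j _ → shifted j))
    (Σ⊕-truncate n (s + n) term (m≤n+m n s) (λ j n≤j →
      cong (_∧ f (n ∸ suc j * k)) (dec-false (suc j * k ≤? n)
        (<⇒≱ (s≤s (≤-trans n≤j (≤-trans (m≤m*n j k) (m≤n+m (j * k) s))))))))

geomTail-shift : ∀ s f → geomTail (suc s) f ≗ shift (suc s) ([1-q^ suc s ]⁻¹· f)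
geomTail-shift s f i with i <? suc s
... | yes i<s = trans (geomTail-low (suc s) f i i<s) (sym (shift-low (suc s) _ i i<s))
... | no i≮s = subst (λ k → geomTail (suc s) f k ≡ shift (suc s) ([1-q^ suc s ]⁻¹· f) k)
  (m+[n∸m]≡n (≮⇒≥ i≮s))
  (trans (geomTail-step s f (i ∸ suc s)) (sym (shift-at (suc s) _ (i ∸ suc s))))

[1-q^]⁻¹-causal : ∀ s → Causal ([1-q^ s ]⁻¹·_)
[1-q^]⁻¹-causal s n e i i≤n = cong₂ _xor_ (e i i≤n) (Σ⊕-cong i (λ j _ →
  cong (does (suc j * s ≤? i) ∧_) (e (i ∸ suc j * s) (≤-trans (m∸n≤m i (suc j * s)) i≤n))))

shift-gain : ∀ s n {f g} → f ≈[ n ] g → shift (suc s) f ≈[ suc n ] shift (suc s) g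
shift-gain s n e zero _ = refl
shift-gain s n e (suc i) (s≤s i≤n) = shift-causal s n e i i≤n

-- Division by 1 - q^s undoes multiplication by 1 + q^s (here 1 - q^s = 1 + q^s).
[1-q^]⁻¹-inverse : ∀ s g → [1-q^ suc s ]⁻¹· [1+q^ suc s ]· g ≗ g
[1-q^]⁻¹-inverse s g i = agree i i ≤-refl
  where
  k = suc s
  D : Series
  D = [1-q^ k ]⁻¹· [1+q^ k ]· g
  -- D = (g + q^k g) + q^k D, so D agrees with g wherever q^k D agrees with q^k g.
  step : ∀ {n} → shift k D ≈[ n ] shift k g → D ≈[ n ] g
  step shifted i i≤n = begin
    (g i xor shift k g i) xor geomTail k ([1+q^ k ]· g) i
      ≡⟨ cong ((g i xor shift k g i) xor_) (geomTail-shift s ([1+q^ k ]· g) i) ⟩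
    (g i xor shift k g i) xor shift k D i
      ≡⟨ cong ((g i xor shift k g i) xor_) (shifted i i≤n) ⟩
    (g i xor shift k g i) xor shift k g i
      ≡⟨ xor-cancelʳ (g i) (shift k g i) ⟩
    g i
      ∎
    where open ≡-Reasoning
  agree : ∀ n → D ≈[ n ] g
  agree zero = step (λ { zero _ → refl ; (suc _) () })
  agree (suc n) = step (shift-gain s n (agree n))

infixr 7 ∏[1-q^_]⁻¹·_
∏[1-q^_]⁻¹·_ : List ℕ → Series → Series
∏[1-q^ [] ]⁻¹· f = f
∏[1-q^ x ∷ xs ]⁻¹· f = [1-q^ x ]⁻¹· ∏[1-q^ xs ]⁻¹· f

∏⁻¹-causal : ∀ xs → Causal (∏[1-q^ xs ]⁻¹·_)
∏⁻¹-causal [] n e = e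
∏⁻¹-causal (x ∷ xs) n e = [1-q^]⁻¹-causal x n (∏⁻¹-causal xs n e)

∏⁻¹-inverse : ∀ xs → All (0 <_) xs → ∀ g → ∏[1-q^ xs ]⁻¹· ∏[1+q^ reverse xs ]· g ≗ g
∏⁻¹-inverse [] [] g i = refl
∏⁻¹-inverse (suc s ∷ xs) (s≤s z≤n ∷ pos) g i = begin
  ([1-q^ suc s ]⁻¹· ∏[1-q^ xs ]⁻¹· ∏[1+q^ reverse (suc s ∷ xs) ]· g) i
    ≡⟨ cong (λ ys → ([1-q^ suc s ]⁻¹· ∏[1-q^ xs ]⁻¹· ∏[1+q^ ys ]· g) i) (unfold-reverse (suc s) xs) ⟩
  ([1-q^ suc s ]⁻¹· ∏[1-q^ xs ]⁻¹· ∏[1+q^ reverse xs ++ [ suc s ] ]· g) i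
    ≡⟨ cong (λ h → ([1-q^ suc s ]⁻¹· ∏[1-q^ xs ]⁻¹· h) i) (∏-++ (reverse xs) [ suc s ] g) ⟩
  ([1-q^ suc s ]⁻¹· ∏[1-q^ xs ]⁻¹· ∏[1+q^ reverse xs ]· [1+q^ suc s ]· g) i
    ≡⟨ causal-cong ([1-q^]⁻¹-causal (suc s)) (∏⁻¹-inverse xs pos ([1+q^ suc s ]· g)) i ⟩
  ([1-q^ suc s ]⁻¹· [1+q^ suc s ]· g) i
    ≡⟨ [1-q^]⁻¹-inverse s g i ⟩
  g i
    ∎
  where open ≡-Reasoning

parity : ℕ → Bool
parity zero = false
parity (suc n) = not (parity n)

parity-+ : ∀ a b → parity (a + b) ≡ parity a xor parity b
parity-+ zero b = refl
parity-+ (suc a) b = trans (cong not (parity-+ a b)) (not-xor (parity a) (parity b))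
  where
  not-xor : ∀ x y → not (x xor y) ≡ not x xor y
  not-xor false y = refl
  not-xor true y = not-involutive y

parity-* : ∀ a b → parity (a * b) ≡ parity a ∧ parity b
parity-* zero b = refl
parity-* (suc a) b =
  trans (parity-+ b (a * b)) (trans (cong (parity b xor_) (parity-* a b)) (add-and (parity b) (parity a)))
  where
  add-and : ∀ y x → y xor (x ∧ y) ≡ not x ∧ y
  add-and y false = xor-identityʳ y
  add-and false true = refl
  add-and true true = refl

parity-double : ∀ m → parity (m + m) ≡ false
parity-double zero = refl
parity-double (suc m) rewrite +-suc m m = cong (λ b → not (not b)) (parity-double m)

parity-mod6 : ∀ s → parity s ≡ parity (s % 6)
parity-mod6 s = begin
  parity s                                  ≡⟨ cong parity (m≡m%n+[m/n]*n s 6) ⟩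
  parity (s % 6 + s / 6 * 6)                ≡⟨ parity-+ (s % 6) (s / 6 * 6) ⟩
  parity (s % 6) xor parity (s / 6 * 6)     ≡⟨ cong (parity (s % 6) xor_) (parity-* (s / 6) 6) ⟩
  parity (s % 6) xor (parity (s / 6) ∧ false) ≡⟨ cong (parity (s % 6) xor_) (∧-zeroʳ (parity (s / 6))) ⟩
  parity (s % 6) xor false                  ≡⟨ xor-identityʳ (parity (s % 6)) ⟩
  parity (s % 6)                            ∎
  where open ≡-Reasoning

-- A part size s used j ≥ 1 times contributes 0 blocks if 6 ∣ s, 2 blocks
-- (with or without overline) if s ≡ ±2 (mod 6), and 1 block otherwise:
-- in every case the number of blocks has the parity of s.
blocks-parity : ∀ s j → parity (length (blocks s (suc j))) ≡ parity s
blocks-parity s j = trans (by-residue s j) (sym (parity-mod6 s))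
  where
  by-residue : ∀ s j → parity (length (blocks s (suc j))) ≡ parity (s % 6)
  by-residue s j with s % 6 | m%n<n s 6
  ... | 0 | _ = refl
  ... | 1 | _ = refl
  ... | 2 | _ = refl
  ... | 3 | _ = refl
  ... | 4 | _ = refl
  ... | 5 | _ = refl
  ... | suc (suc (suc (suc (suc (suc _))))) | s≤s (s≤s (s≤s (s≤s (s≤s (s≤s ())))))

listSum : ∀ {A : Set} → (A → Bool) → List A → Bool
listSum g [] = false
listSum g (x ∷ xs) = g x xor listSum g xs

parity-concatMap : ∀ {A B : Set} (f : A → List B) xs →
  parity (length (concatMap f xs)) ≡ listSum (λ x → parity (length (f x))) xs
parity-concatMap f [] = refl
parity-concatMap f (x ∷ xs) =
  trans (cong parity (length-++ (f x)))
  (trans (parity-+ (length (f x)) _) (cong (parity (length (f x)) xor_) (parity-concatMap f xs)))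

length-prefixes : ∀ {B : Set} (X bs : List (List B)) →
  length (concatMap (λ b → map (b ++_) X) bs) ≡ length bs * length X
length-prefixes X [] = refl
length-prefixes X (b ∷ bs) =
  trans (length-++ (map (b ++_) X)) (cong₂ _+_ (length-map (b ++_) X) (length-prefixes X bs))

listSum-filter : ∀ {A : Set} {P : A → Set} (P? : Decidable P) g xs →
  listSum g (filter P? xs) ≡ listSum (λ x → does (P? x) ∧ g x) xs
listSum-filter P? g [] = refl
listSum-filter P? g (x ∷ xs) with does (P? x)
... | true = cong (g x xor_) (listSum-filter P? g xs)
... | false = listSum-filter P? g xs

listSum-applyUpTo : ∀ g (f : ℕ → ℕ) m → listSum g (applyUpTo f m) ≡ Σ⊕ m (λ j → g (f j))
listSum-applyUpTo g f zero = refl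
listSum-applyUpTo g f (suc m) = cong (g (f 0) xor_) (listSum-applyUpTo g (λ j → f (suc j)) m)

-- oddQuot k = ∏_{odd j ≤ k} (1 - q^j)⁻¹ modulo 2: the factor j is divided out iff j is odd.
oddQuot : ℕ → Series
oddQuot zero = 𝟙
oddQuot (suc k) n = oddQuot k n xor (parity (suc k) ∧ geomTail (suc k) (oddQuot k) n)

ops-parity : ∀ k n → parity (length (ops k n)) ≡ oddQuot k n
ops-parity zero zero = refl
ops-parity zero (suc n) = refl
ops-parity (suc k) n = begin
  parity (length (concatMap uses (filter (λ j → j * s ≤? n) multiplicities)))
    ≡⟨ parity-concatMap uses (filter (λ j → j * s ≤? n) multiplicities) ⟩
  listSum (λ j → parity (length (uses j))) (filter (λ j → j * s ≤? n) multiplicities)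
    ≡⟨ listSum-filter (λ j → j * s ≤? n) (λ j → parity (length (uses j))) multiplicities ⟩
  listSum (λ j → does (j * s ≤? n) ∧ parity (length (uses j))) multiplicities
    ≡⟨ listSum-applyUpTo (λ j → does (j * s ≤? n) ∧ parity (length (uses j))) (λ j → j) (suc n) ⟩
  parity (length (uses 0)) xor Σ⊕ n (λ j → does (suc j * s ≤? n) ∧ parity (length (uses (suc j))))
    ≡⟨ cong₂ _xor_ no-use (Σ⊕-cong n (λ j _ → repeated-use j)) ⟩
  oddQuot k n xor Σ⊕ n (λ j → parity s ∧ (does (suc j * s ≤? n) ∧ oddQuot k (n ∸ suc j * s)))
    ≡⟨ cong (oddQuot k n xor_) (Σ⊕-scale n (parity s) _) ⟩
  oddQuot (suc k) n
    ∎
  where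
  open ≡-Reasoning
  s = suc k
  multiplicities : List ℕ
  multiplicities = upTo (suc n)
  uses : ℕ → List (List (ℕ × Bool))
  uses j = concatMap (λ b → map (b ++_) (ops k (n ∸ j * s))) (blocks s j)
  parity-uses : ∀ j →
    parity (length (uses j)) ≡ parity (length (blocks s j)) ∧ parity (length (ops k (n ∸ j * s)))
  parity-uses j = trans (cong parity (length-prefixes (ops k (n ∸ j * s)) (blocks s j)))
    (parity-* (length (blocks s j)) (length (ops k (n ∸ j * s))))
  no-use : parity (length (uses 0)) ≡ oddQuot k n
  no-use = trans (parity-uses 0) (ops-parity k n)
  repeated-use : ∀ j → (does (suc j * s ≤? n) ∧ parity (length (uses (suc j))))
                     ≡ parity s ∧ (does (suc j * s ≤? n) ∧ oddQuot k (n ∸ suc j * s))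
  repeated-use j rewrite parity-uses (suc j) | blocks-parity s j | ops-parity k (n ∸ suc j * s) =
    trans (sym (∧-assoc (does (suc j * s ≤? n)) (parity s) _))
    (trans (cong (_∧ oddQuot k (n ∸ suc j * s)) (∧-comm (does (suc j * s ≤? n)) (parity s)))
    (∧-assoc (parity s) _ _))

oddQuot-stable : ∀ d n → oddQuot (d + n) n ≡ oddQuot n n
oddQuot-stable zero n = refl
oddQuot-stable (suc d) n = begin
  oddQuot (d + n) n xor (parity (suc d + n) ∧ geomTail (suc d + n) (oddQuot (d + n)) n)
    ≡⟨ cong (λ b → oddQuot (d + n) n xor (parity (suc d + n) ∧ b))
            (geomTail-low (suc d + n) (oddQuot (d + n)) n (s≤s (m≤n+m n d))) ⟩
  oddQuot (d + n) n xor (parity (suc d + n) ∧ false)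
    ≡⟨ cong (oddQuot (d + n) n xor_) (∧-zeroʳ (parity (suc d + n))) ⟩
  oddQuot (d + n) n xor false
    ≡⟨ xor-identityʳ (oddQuot (d + n) n) ⟩
  oddQuot (d + n) n
    ≡⟨ oddQuot-stable d n ⟩
  oddQuot n n
    ∎
  where open ≡-Reasoning

oddQuot-double : ∀ m → oddQuot (m + m) ≗ ∏[1-q^ odds m ]⁻¹· 𝟙
oddQuot-double zero i = refl
oddQuot-double (suc m) i rewrite +-suc m m | parity-double m =
  trans (xor-identityʳ _) (causal-cong ([1-q^]⁻¹-causal (suc (m + m))) (oddQuot-double m) i)

odds-positive : ∀ m → All (0 <_) (odds m)
odds-positive zero = []
odds-positive (suc m) = s≤s z≤n ∷ odds-positive m

oddQuot≡euler : ∀ n → oddQuot n n ≡ eulerProd n n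
oddQuot≡euler n = begin
  oddQuot n n
    ≡⟨ oddQuot-stable n n ⟨
  oddQuot (n + n) n
    ≡⟨ oddQuot-double n n ⟩
  (∏[1-q^ odds n ]⁻¹· 𝟙) n
    ≡⟨ ∏⁻¹-causal (odds n) n cancel n ≤-refl ⟩
  (∏[1-q^ odds n ]⁻¹· ∏[1+q^ reverse (odds n) ]· eulerProd n) n
    ≡⟨ ∏⁻¹-inverse (odds n) (odds-positive n) (eulerProd n) n ⟩
  eulerProd n n
    ∎
  where
  open ≡-Reasoning
  cancel : 𝟙 ≈[ n ] ∏[1+q^ reverse (odds n) ]· eulerProd n
  cancel i i≤n = sym (trans (∏-perm (↭.↭-reverse (odds n)) (eulerProd n) i) (odd-euler-cancel n i i≤n))

-- above k N lists the exponents N, N-1, …, k+1 of ∏_{j=k+1}^{N} (1 + q^j); it grows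
-- at the top when N increases and loses k+1 at the bottom when k increases.
above : ℕ → ℕ → List ℕ
above k zero = []
above k (suc n) = if does (k ≤? n) then suc n ∷ above k n else []

above-top : ∀ {k n} → k ≤ n → above k (suc n) ≡ suc n ∷ above k n
above-top {k} {n} k≤n rewrite dec-true (k ≤? n) k≤n = refl

above-empty : ∀ {k n} → n ≤ k → above k n ≡ []
above-empty {k} {zero} _ = refl
above-empty {k} {suc n} n<k rewrite dec-false (k ≤? n) (<⇒≱ n<k) = refl

above-bottom : ∀ {k n} → k < n → above k n ≡ above (suc k) n ++ [ suc k ]
above-bottom {k} {suc n} (s≤s k≤n) with m≤n⇒m<n∨m≡n k≤n
... | inj₁ k<n rewrite above-top k≤n | above-top k<n = cong (suc n ∷_) (above-bottom k<n)
... | inj₂ refl rewrite above-top k≤n | above-empty (≤-refl {k}) | above-empty (≤-refl {suc k}) = refl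

above-zero : ∀ n → above 0 n ≡ positives n
above-zero zero = refl
above-zero (suc n) = cong (suc n ∷_) (above-zero n)

tri : ℕ → ℕ
tri zero = 0
tri (suc k) = tri k + suc k

-- Shanks' finite form of Euler's pentagonal theorem, reduced modulo 2:
-- (q;q)_N = Σ_{k=0}^{N} q^{T_k + Nk} ∏_{j=k+1}^{N} (1 + q^j).
shanksTerm : ℕ → ℕ → Series
shanksTerm N k = ∏[1+q^ above k N ]· q^ (tri k + N * k)

shanksSum : ℕ → Series
shanksSum N i = Σ⊕ (suc N) (λ k → shanksTerm N k i)

-- Passing from N to N+1 changes the k-th term by correction N k + correction N (k+1),
-- so that the total changes only by two monomials (a telescoping sum).
correction : ℕ → ℕ → Series
correction N zero = 𝟘
correction N (suc k) = ∏[1+q^ above k N ]· q^ (tri (suc k) + N * suc k)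

∏-binomial : ∀ xs x e → ∏[1+q^ xs ]· [1+q^ x ]· q^ e ≗ ∏[1+q^ xs ]· q^ e ⊕ ∏[1+q^ xs ]· q^ (x + e)
∏-binomial xs x e = ≗-trans (∏-cong xs ([1+q^]-q^ x e)) (∏-⊕ xs (q^ e) (q^ (x + e)))

shanksTerm-lower : ∀ N k → k ≤ N →
  shanksTerm N k ⊕ correction N k ≗ ∏[1+q^ above k N ]· q^ (k + (tri k + N * k))
shanksTerm-lower N zero _ i = xor-identityʳ _
shanksTerm-lower N (suc k) k<N i = begin
  R (q^ E) i xor (∏[1+q^ above k N ]· q^ E) i
    ≡⟨ cong (λ xs → R (q^ E) i xor (∏[1+q^ xs ]· q^ E) i) (above-bottom k<N) ⟩
  R (q^ E) i xor (∏[1+q^ above (suc k) N ++ [ suc k ] ]· q^ E) i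
    ≡⟨ cong (λ h → R (q^ E) i xor h i) (∏-++ (above (suc k) N) [ suc k ] (q^ E)) ⟩
  R (q^ E) i xor R ([1+q^ suc k ]· q^ E) i
    ≡⟨ cong (R (q^ E) i xor_) (∏-binomial (above (suc k) N) (suc k) E i) ⟩
  R (q^ E) i xor (R (q^ E) i xor R (q^ (suc k + E)) i)
    ≡⟨ xor-cancelˡ (R (q^ E) i) (R (q^ (suc k + E)) i) ⟩
  R (q^ (suc k + E)) i
    ∎
  where
  open ≡-Reasoning
  E = tri (suc k) + N * suc k
  R : Series → Series
  R = ∏[1+q^ above (suc k) N ]·_

shanksTerm-raise : ∀ N k → k ≤ N →
  shanksTerm (suc N) k ≗ ∏[1+q^ above k N ]· q^ (k + (tri k + N * k)) ⊕ correction N (suc k)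
shanksTerm-raise N k k≤N i = begin
  (∏[1+q^ above k (suc N) ]· q^ (tri k + suc N * k)) i
    ≡⟨ cong (λ xs → (∏[1+q^ xs ]· q^ (tri k + suc N * k)) i) (above-top k≤N) ⟩
  ([1+q^ suc N ]· R (q^ (tri k + suc N * k))) i
    ≡⟨ cong (λ e → ([1+q^ suc N ]· R (q^ e)) i) (exponent-at-N+1 N k (tri k)) ⟩
  ([1+q^ suc N ]· R (q^ (k + E))) i
    ≡⟨ ∏-[1+q^]-comm (above k N) (suc N) (q^ (k + E)) i ⟨
  R ([1+q^ suc N ]· q^ (k + E)) i
    ≡⟨ ∏-binomial (above k N) (suc N) (k + E) i ⟩
  R (q^ (k + E)) i xor R (q^ (suc N + (k + E))) i
    ≡⟨ cong (λ e → R (q^ (k + E)) i xor R (q^ e) i) (next-exponent N k (tri k)) ⟨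
  R (q^ (k + E)) i xor correction N (suc k) i
    ∎
  where
  open ≡-Reasoning
  E = tri k + N * k
  R : Series → Series
  R = ∏[1+q^ above k N ]·_
  exponent-at-N+1 : ∀ N k t → t + suc N * k ≡ k + (t + N * k)
  exponent-at-N+1 = solve-∀
  next-exponent : ∀ N k t → (t + suc k) + N * suc k ≡ suc N + (k + (t + N * k))
  next-exponent = solve-∀

shanksTerm-recurrence : ∀ N k → k ≤ N → ∀ i →
  shanksTerm (suc N) k i ≡ shanksTerm N k i xor (correction N k i xor correction N (suc k) i)
shanksTerm-recurrence N k k≤N i =
  trans (shanksTerm-raise N k k≤N i)
  (trans (cong (_xor correction N (suc k) i) (sym (shanksTerm-lower N k k≤N i)))
         (xor-assoc (shanksTerm N k i) (correction N k i) (correction N (suc k) i)))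

shanksSum-step : ∀ N i → shanksSum (suc N) i ≡
  (shanksSum N i xor (q^ (tri (suc N) + N * suc N)) i) xor (q^ (tri (suc N) + suc N * suc N)) i
shanksSum-step N i = begin
  Σ⊕ (suc (suc N)) (λ k → shanksTerm (suc N) k i)
    ≡⟨ Σ⊕-last (suc N) (λ k → shanksTerm (suc N) k i) ⟩
  Σ⊕ (suc N) (λ k → shanksTerm (suc N) k i) xor shanksTerm (suc N) (suc N) i
    ≡⟨ cong₂ _xor_ telescoped
         (cong (λ xs → (∏[1+q^ xs ]· q^ (tri (suc N) + suc N * suc N)) i) (above-empty (≤-refl {suc N}))) ⟩
  (shanksSum N i xor (q^ (tri (suc N) + N * suc N)) i) xor (q^ (tri (suc N) + suc N * suc N)) i
    ∎
  where
  open ≡-Reasoning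
  c : ℕ → Bool
  c k = correction N k i
  telescoped : Σ⊕ (suc N) (λ k → shanksTerm (suc N) k i) ≡ shanksSum N i xor (q^ (tri (suc N) + N * suc N)) i
  telescoped = begin
    Σ⊕ (suc N) (λ k → shanksTerm (suc N) k i)
      ≡⟨ Σ⊕-cong (suc N) (λ k k<N+1 → shanksTerm-recurrence N k (≤-pred k<N+1) i) ⟩
    Σ⊕ (suc N) (λ k → shanksTerm N k i xor (c k xor c (suc k)))
      ≡⟨ Σ⊕-⊕ (suc N) (λ k → shanksTerm N k i) (λ k → c k xor c (suc k)) ⟩
    shanksSum N i xor Σ⊕ (suc N) (λ k → c k xor c (suc k))
      ≡⟨ cong (shanksSum N i xor_) (Σ⊕-telescope (suc N) c) ⟩
    shanksSum N i xor (false xor c (suc N))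
      ≡⟨ cong (λ xs → shanksSum N i xor (∏[1+q^ xs ]· q^ (tri (suc N) + N * suc N)) i)
              (above-empty (≤-refl {N})) ⟩
    shanksSum N i xor (q^ (tri (suc N) + N * suc N)) i
      ∎

-- Generalized pentagonal numbers j(3j+1)/2 and (j+1)(3j+2)/2.
Pentagonal : ℕ → Set
Pentagonal i = ∃[ j ] (i ≡ tri j + j * j ⊎ i ≡ tri (suc j) + j * suc j)

q^-support : ∀ e i → (q^ e) i ≡ true → i ≡ e
q^-support e i eq = ≡ᵇ⇒≡ i e (subst T (sym eq) tt)

shanks-support : ∀ N i → shanksSum N i ≡ true → Pentagonal i
shanks-support zero i eq = 0 , inj₁ (q^-support 0 i (trans (sym (xor-identityʳ _)) eq))
shanks-support (suc N) i eq with xor-true _ _ _ (trans (sym (shanksSum-step N i)) eq)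
... | inj₁ (inj₁ earlier) = shanks-support N i earlier
... | inj₁ (inj₂ new₁) = N , inj₂ (q^-support _ i new₁)
... | inj₂ new₂ = suc N , inj₁ (q^-support _ i new₂)

-- Below degree N+1 only the term k = 0, which is (q;q)_N itself, contributes.
shanks-low : ∀ N → shanksSum N ≈[ N ] eulerProd N
shanks-low N i i≤N = begin
  shanksTerm N 0 i xor Σ⊕ N (λ k → shanksTerm N (suc k) i)
    ≡⟨ cong (shanksTerm N 0 i xor_) (Σ⊕-truncate zero N _ z≤n (λ k _ → high-term k)) ⟩
  shanksTerm N 0 i xor false
    ≡⟨ xor-identityʳ _ ⟩
  (∏[1+q^ above 0 N ]· q^ (N * 0)) i
    ≡⟨ cong₂ (λ xs e → (∏[1+q^ xs ]· q^ e) i) (above-zero N) (*-zeroʳ N) ⟩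
  eulerProd N i
    ∎
  where
  open ≡-Reasoning
  high-term : ∀ k → shanksTerm N (suc k) i ≡ false
  high-term k = trans (∏-causal (above (suc k) N) N (q^-high N<e) i i≤N) (∏-𝟘 (above (suc k) N) i)
    where
    N<e : N < tri (suc k) + N * suc k
    N<e = ≤-trans (s≤s (m≤m*n N (suc k)))
                  (+-monoˡ-≤ (N * suc k) (≤-trans (s≤s z≤n) (m≤n+m (suc k) (tri k))))

tri-double : ∀ j → tri j + tri j ≡ j * suc j
tri-double zero = refl
tri-double (suc j) = begin
  (tri j + suc j) + (tri j + suc j)  ≡⟨ regroup (tri j) j ⟩
  (tri j + tri j) + 2 * suc j        ≡⟨ cong (_+ 2 * suc j) (tri-double j) ⟩
  j * suc j + 2 * suc j              ≡⟨ expand j ⟩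
  suc j * suc (suc j)                ∎
  where
  open ≡-Reasoning
  regroup : ∀ t j → (t + suc j) + (t + suc j) ≡ (t + t) + 2 * suc j
  regroup = solve-∀
  expand : ∀ j → j * suc j + 2 * suc j ≡ suc j * suc (suc j)
  expand = solve-∀

pentagonal-square : ∀ {n} → Pentagonal n → ∃[ x ] x * x ≡ 24 * n + 1
pentagonal-square (j , inj₁ refl) = 6 * j + 1 , (begin
  (6 * j + 1) * (6 * j + 1)              ≡⟨ lhs j ⟩
  12 * (j * suc j) + 24 * (j * j) + 1    ≡⟨ cong (λ d → 12 * d + 24 * (j * j) + 1) (tri-double j) ⟨
  12 * (tri j + tri j) + 24 * (j * j) + 1  ≡⟨ rhs (tri j) j ⟩
  24 * (tri j + j * j) + 1               ∎)
  where
  open ≡-Reasoning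
  lhs : ∀ j → (6 * j + 1) * (6 * j + 1) ≡ 12 * (j * suc j) + 24 * (j * j) + 1
  lhs = solve-∀
  rhs : ∀ t j → 12 * (t + t) + 24 * (j * j) + 1 ≡ 24 * (t + j * j) + 1
  rhs = solve-∀
pentagonal-square (j , inj₂ refl) = 6 * j + 5 , (begin
  (6 * j + 5) * (6 * j + 5)
    ≡⟨ lhs j ⟩
  12 * (j * suc j) + 24 * suc j + 24 * (j * suc j) + 1
    ≡⟨ cong (λ d → 12 * d + 24 * suc j + 24 * (j * suc j) + 1) (tri-double j) ⟨
  12 * (tri j + tri j) + 24 * suc j + 24 * (j * suc j) + 1
    ≡⟨ rhs (tri j) j ⟩
  24 * (tri (suc j) + j * suc j) + 1
    ∎)
  where
  open ≡-Reasoning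
  lhs : ∀ j → (6 * j + 5) * (6 * j + 5) ≡ 12 * (j * suc j) + 24 * suc j + 24 * (j * suc j) + 1
  lhs = solve-∀
  rhs : ∀ t j → 12 * (t + t) + 24 * suc j + 24 * (j * suc j) + 1 ≡ 24 * ((t + suc j) + j * suc j) + 1
  rhs = solve-∀

square-residue : ∀ p r m x → x * x ≡ 24 * (p * m + r) + 1 → (+ p) ∣ (+ x Z.* + x Z.- + (24 * r + 1))
square-residue p r m x sq = subst (λ z → p ∣ℕ Z.∣ z ∣) (sym difference) (m∣m*n (24 * m))
  where
  c = 24 * r + 1
  split : x * x ≡ p * (24 * m) + c
  split = trans sq (regroup p r m)
    where
    regroup : ∀ p r m → 24 * (p * m + r) + 1 ≡ p * (24 * m) + (24 * r + 1)
    regroup = solve-∀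
  difference : + x Z.* + x Z.- + c ≡ + (p * (24 * m))
  difference = begin
    + x Z.* + x Z.- + c            ≡⟨ cong (Z._- + c) (Zₚ.pos-* x x) ⟨
    + (x * x) Z.- + c              ≡⟨ cong (λ z → + z Z.- + c) split ⟩
    + (p * (24 * m) + c) Z.- + c   ≡⟨ Zₚ.m-n≡m⊖n (p * (24 * m) + c) c ⟩
    (p * (24 * m) + c) Z.⊖ c       ≡⟨ Zₚ.⊖-≥ (m≤n+m c (p * (24 * m))) ⟩
    + (p * (24 * m) + c ∸ c)       ≡⟨ cong +_ (m+n∸n≡m (p * (24 * m)) c) ⟩
    + (p * (24 * m))               ∎
    where open ≡-Reasoning

parity-even : ∀ n → parity n ≡ false → n % 2 ≡ 0
parity-even n even-parity with halve n
... | even m = subst (λ k → k % 2 ≡ 0) (double-as-product m) (m*n%n≡0 m 2)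
  where
  double-as-product : ∀ m → m * 2 ≡ m + m
  double-as-product = solve-∀
... | odd m with trans (sym (cong not (parity-double m))) even-parity
... | ()

Cbar62-odd⇒pentagonal : ∀ n → parity (Cbar62 n) ≡ true → Pentagonal n
Cbar62-odd⇒pentagonal n odd-parity = shanks-support n n (begin
  shanksSum n n           ≡⟨ shanks-low n n ≤-refl ⟩
  eulerProd n n           ≡⟨ oddQuot≡euler n ⟨
  oddQuot n n             ≡⟨ ops-parity n n ⟨
  parity (Cbar62 n)       ≡⟨ odd-parity ⟩
  true                    ∎)
  where open ≡-Reasoning

-- Were C̄_{6,2}(pm + r) odd, pm + r would be pentagonal and 24r + 1 a square modulo p.
mainTheorem17 : (p r : ℕ) → Prime p → 5 ≤ p → 1 ≤ r → r ≤ p ∸ 1 →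
    ¬ (∃ λ (x : ℤ) → (+ p) ∣ (x Z.* x Z.- (+ (24 * r + 1)))) →
    (m : ℕ) → Cbar62 (p * m + r) % 2 ≡ 0
mainTheorem17 p r _ _ _ _ nonResidue m with parity (Cbar62 (p * m + r)) in parity≡
... | false = parity-even (Cbar62 (p * m + r)) parity≡
... | true with pentagonal-square (Cbar62-odd⇒pentagonal (p * m + r) parity≡)
...   | x , x²≡ = ⊥-elim (nonResidue (+ x , square-residue p r m x x²≡))
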